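{- Let $\mathcal{S}=[s_0,\ldots,s_{k-1}]$ be a binary $(n,R)$-covering sequence of length $k$, and for an integer $j$ let $\mathbf{E}^j\mathcal{S}=[s_j,s_{j+1},\ldots,s_{k-1},s_0,\ldots,s_{j-1}]$ (indices mod $k$) denote its cyclic left shift by $j$. If $k$ is even, let $\mathcal{A}$ be the $(k+1)\times k$ array whose $i$-th row, $0\le i\le k-1$, is $\mathbf{E}^{i(i+1)/2}\mathcal{S}$ and whose $k$-th row equals its $(k-1)$-th row; then $\mathcal{A}$ is a $(2\times n,2R)$-covering 2D-sequence. If $k$ is odd, let $\mathcal{A}$ be the $k\times k$ array whose $i$-th row, $0\le i\le k-1$, is $\mathbf{E}^{i(i+1)/2}\mathcal{S}$; then $\mathcal{A}$ is a $(2\times n,2R)$-covering 2D-sequence.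
   Context: A cyclic binary sequence of length $k$ has as its windows of length $n$ the words $(s_i,\ldots,s_{i+n-1})$, $0\le i\le k-1$, indices modulo $k$; it is an $(n,R)$-covering sequence if every $x\in\{0,1\}^n$ is within Hamming distance $R$ of some window. An $M\times N$ binary array $A=(A_{r,c})$ is regarded as doubly periodic (a torus); its $m\times n$ windows are the arrays $(A_{(r+a)\bmod M,\,(c+b)\bmod N})_{0\le a<m,\,0\le b<n}$ for $0\le r<M$, $0\le c<N$. It is an $(m\times n,R)$-covering 2D-sequence if for every binary $m\times n$ matrix $B$ there is a window $X$ with $d(B,X)\le R$, where $d$ counts differing entries. -}

module Defs where

open import Data.Nat using (ℕ; zero; suc; _+_; _*_; _≤_; NonZero)
open import Data.Nat.DivMod using (_%_; _/_)
open import Data.Nat.Properties using (_≟_)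
open import Data.Bool using (Bool; true; false; if_then_else_)
open import Data.Fin using (Fin; toℕ; fromℕ<)
open import Data.Product using (∃; ∃-syntax; Σ; _×_)
open import Relation.Nullary.Decidable using (does)
open import Data.Nat.DivMod using (m%n<n)

dist : ∀ {n} → (Fin n → Bool) → (Fin n → Bool) → ℕ
dist {zero}  x y = 0
dist {suc n} x y =
  (if does (Data.Bool._≟_ (x Data.Fin.zero) (y Data.Fin.zero)) then 0 else 1)
  + dist (λ i → x (Data.Fin.suc i)) (λ i → y (Data.Fin.suc i))

modFin : (k : ℕ) → .{{_ : NonZero k}} → ℕ → Fin k
modFin k m = fromℕ< (m%n<n m k)

window : ∀ {k} .{{_ : NonZero k}} (n : ℕ) → (Fin k → Bool) → Fin k → (Fin n → Bool)
window {k} n s i b = s (modFin k (toℕ i + toℕ b))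

IsCoveringSeq : ∀ {k} .{{_ : NonZero k}} (n R : ℕ) → (Fin k → Bool) → Set
IsCoveringSeq {k} n R s =
  (x : Fin n → Bool) → ∃[ i ] dist x (window n s i) ≤ R

dist2 : ∀ {m n} → (Fin m → Fin n → Bool) → (Fin m → Fin n → Bool) → ℕ
dist2 {zero}  B X = 0
dist2 {suc m} B X =
  dist (B Data.Fin.zero) (X Data.Fin.zero)
  + dist2 (λ a → B (Data.Fin.suc a)) (λ a → X (Data.Fin.suc a))

window2 : ∀ {M N} .{{_ : NonZero M}} .{{_ : NonZero N}} (m n : ℕ) →
          (Fin M → Fin N → Bool) → Fin M → Fin N → (Fin m → Fin n → Bool)
window2 {M} {N} m n A r c a b =
  A (modFin M (toℕ r + toℕ a)) (modFin N (toℕ c + toℕ b))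

IsCovering2D : ∀ {M N} .{{_ : NonZero M}} .{{_ : NonZero N}} (m n R : ℕ) →
               (Fin M → Fin N → Bool) → Set
IsCovering2D {M} {N} m n R A =
  (B : Fin m → Fin n → Bool) →
  ∃[ r ] ∃[ c ] dist2 B (window2 m n A r c) ≤ R

shift : ∀ {k} .{{_ : NonZero k}} → ℕ → (Fin k → Bool) → (Fin k → Bool)
shift {k} j s c = s (modFin k (j + toℕ c))

tri : ℕ → ℕ
tri i = (i * suc i) / 2

arrayEven : ∀ {k} .{{_ : NonZero k}} → (Fin k → Bool) → Fin (suc k) → Fin k → Bool
arrayEven {suc k'} s r =
  if does (toℕ r ≟ suc k') then shift (tri k') s else shift (tri (toℕ r)) s

arrayOdd : ∀ {k} .{{_ : NonZero k}} → (Fin k → Bool) → Fin k → Fin k → Bool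
arrayOdd s r = shift (tri (toℕ r)) s

{-# OPTIONS --safe #-}
-- Choose windows a, b of S covering the two rows of the pattern and let d ≡ b - a (mod k).
-- Row i of the array is E^{T_i} S with T_i = i(i+1)/2, so consecutive rows i - 1 and i
-- differ by the shift T_i - T_{i-1} = i, which realises every d in 1 … k - 1; a column
-- offset c with T_{i-1} + c ≡ a then places the windows a and a + d = b under the pattern.
-- The difference d = 0 is realised by the duplicated last row when k is even, and by the
-- cyclic pair of rows k - 1 and 0 when k is odd, since then k divides T_{k-1} = k(k-1)/2.
module Submission where

open import Defs
open import Data.Nat using (ℕ; zero; suc; _+_; _*_; _≤_; _<_; z≤n; NonZero)
open import Data.Nat.Properties
open import Data.Nat.DivMod
open import Data.Nat.Divisibility using (_∣_; _∣0; ∣-refl; ∣m∣n⇒∣m+n; m∣m*n; n∣m*n; n∣m⇒m%n≡0)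
open import Data.Nat.Solver using (module +-*-Solver)
open import Data.Bool using (Bool)
open import Data.Fin using (Fin; toℕ; fromℕ<) renaming (zero to fzero; suc to fsuc)
open import Data.Fin.Properties using (toℕ-fromℕ<; toℕ-injective; toℕ<n)
open import Data.Product using (_×_; _,_; ∃-syntax)
open import Data.Sum using (_⊎_; inj₁; inj₂)
open import Relation.Nullary using (¬_; contradiction)
open import Relation.Nullary.Decidable using (dec-true; dec-false)
open import Relation.Binary.PropositionalEquality
open +-*-Solver
open ≡-Reasoning

private
  variable
    k' n R : ℕ

module _ {K : ℕ} .{{_ : NonZero K}} where

  toℕ-modFin : ∀ u → toℕ (modFin K u) ≡ u % K
  toℕ-modFin u = toℕ-fromℕ< (m%n<n u K)

  toℕ%≡toℕ : (a : Fin K) → toℕ a % K ≡ toℕ a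
  toℕ%≡toℕ a = m<n⇒m%n≡m (toℕ<n a)

  modFin-≡ : ∀ u {a : Fin K} → u % K ≡ toℕ a → modFin K u ≡ a
  modFin-≡ u e = toℕ-injective (trans (toℕ-modFin u) e)

  modFin-cong : ∀ u v → u % K ≡ v % K → modFin K u ≡ modFin K v
  modFin-cong u v e = modFin-≡ u (trans e (sym (toℕ-modFin v)))

  modFin-toℕ : (a : Fin K) → modFin K (toℕ a) ≡ a
  modFin-toℕ a = modFin-≡ (toℕ a) (toℕ%≡toℕ a)

  [m%o+n]%o≡[m+n]%o : ∀ m n → (m % K + n) % K ≡ (m + n) % K
  [m%o+n]%o≡[m+n]%o m n = begin
    (m % K + n) % K          ≡⟨ %-distribˡ-+ (m % K) n K ⟩
    (m % K % K + n % K) % K  ≡⟨ cong (λ x → (x + n % K) % K) (m%n%n≡m%n m K) ⟩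
    (m % K + n % K) % K      ≡⟨ %-distribˡ-+ m n K ⟨
    (m + n) % K              ∎

  [m+n%o]%o≡[m+n]%o : ∀ m n → (m + n % K) % K ≡ (m + n) % K
  [m+n%o]%o≡[m+n]%o m n = begin
    (m + n % K) % K  ≡⟨ cong (_% K) (+-comm m (n % K)) ⟩
    (n % K + m) % K  ≡⟨ [m%o+n]%o≡[m+n]%o n m ⟩
    (n + m) % K      ≡⟨ cong (_% K) (+-comm n m) ⟩
    (m + n) % K      ∎

  m+toℕ[modFin-n]%o≡[m+n]%o : ∀ m n → (m + toℕ (modFin K n)) % K ≡ (m + n) % K
  m+toℕ[modFin-n]%o≡[m+n]%o m n =
    trans (cong (λ x → (m + x) % K) (toℕ-modFin n)) ([m+n%o]%o≡[m+n]%o m n)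

  %-cong-+ʳ : ∀ {u v} w → u % K ≡ v % K → (u + w) % K ≡ (v + w) % K
  %-cong-+ʳ {u} {v} w e = begin
    (u + w) % K      ≡⟨ [m%o+n]%o≡[m+n]%o u w ⟨
    (u % K + w) % K  ≡⟨ cong (λ x → (x + w) % K) e ⟩
    (v % K + w) % K  ≡⟨ [m%o+n]%o≡[m+n]%o v w ⟩
    (v + w) % K      ∎

-- Subtraction of m modulo 1 + k is encoded as addition of k * m.
[m+[n+k*m]]%[1+k]≡n%[1+k] : ∀ k m n → (m + (n + k * m)) % suc k ≡ n % suc k
[m+[n+k*m]]%[1+k]≡n%[1+k] k m n = begin
  (m + (n + k * m)) % suc k  ≡⟨ cong (_% suc k)
                                  (solve 3 (λ k m n → m :+ (n :+ k :* m) := n :+ m :* (con 1 :+ k)) refl k m n) ⟩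
  (n + m * suc k) % suc k    ≡⟨ [m+kn]%n≡m%n n m (suc k) ⟩
  n % suc k                  ∎

dist-congʳ : ∀ {n} (x : Fin n → Bool) {y z : Fin n → Bool} → y ≗ z → dist x y ≡ dist x z
dist-congʳ {zero}  x y≗z = refl
dist-congʳ {suc n} x y≗z rewrite y≗z fzero =
  cong (_ +_) (dist-congʳ (λ i → x (fsuc i)) (λ i → y≗z (fsuc i)))

module _ {K : ℕ} .{{_ : NonZero K}} (s : Fin K → Bool) where

  shift-cong-% : ∀ T T' → T % K ≡ T' % K → shift T s ≗ shift T' s
  shift-cong-% T T' e c = cong s (modFin-cong _ _ (%-cong-+ʳ (toℕ c) e))

  window-shift : ∀ n T (c : Fin K) → window n (shift T s) c ≗ window n s (modFin K (T + toℕ c))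
  window-shift n T c j = cong s (modFin-cong _ _ (begin
    (T + toℕ (modFin K (toℕ c + toℕ j))) % K  ≡⟨ m+toℕ[modFin-n]%o≡[m+n]%o T (toℕ c + toℕ j) ⟩
    (T + (toℕ c + toℕ j)) % K                 ≡⟨ cong (_% K) (+-assoc T (toℕ c) (toℕ j)) ⟨
    (T + toℕ c + toℕ j) % K                   ≡⟨ [m%o+n]%o≡[m+n]%o (T + toℕ c) (toℕ j) ⟨
    ((T + toℕ c) % K + toℕ j) % K             ≡⟨ cong (λ x → (x + toℕ j) % K) (toℕ-modFin (T + toℕ c)) ⟨
    (toℕ (modFin K (T + toℕ c)) + toℕ j) % K  ∎))

  window-of-shifted : ∀ {row : Fin K → Bool} T c {a} →
    row ≗ shift T s → modFin K (T + toℕ c) ≡ a → window n row c ≗ window n s a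
  window-of-shifted {n = n} T c row≗ e j =
    trans (row≗ _) (trans (window-shift n T c j) (cong (λ a → window n s a j) e))

RowsShiftedBy : ∀ {M K} .{{_ : NonZero M}} .{{_ : NonZero K}} →
  (Fin M → Fin K → Bool) → (Fin K → Bool) → ℕ → Set
RowsShiftedBy {M} A s d =
  ∃[ r ] ∃[ T ] (A r ≗ shift T s × A (modFin M (toℕ r + 1)) ≗ shift (T + d) s)

covering2D-of-rowsShiftedBy : ∀ {M} .{{_ : NonZero M}}
  (A : Fin M → Fin (suc k') → Bool) (s : Fin (suc k') → Bool) →
  IsCoveringSeq n R s → (∀ d → d < suc k' → RowsShiftedBy A s d) →
  IsCovering2D 2 n (2 * R) A
covering2D-of-rowsShiftedBy {k'} {n} {R} {M} A s cov rows B
  with cov (B fzero) | cov (B (fsuc fzero))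
... | a , a-close | b , b-close
  with rows ((toℕ b + k' * toℕ a) % suc k') (m%n<n (toℕ b + k' * toℕ a) (suc k'))
... | r , T , row₀ , row₁ = r , c , bound
  where
  K = suc k'
  d = (toℕ b + k' * toℕ a) % K
  c = modFin K (toℕ a + k' * T)

  T+c≡a : (T + toℕ c) % K ≡ toℕ a % K
  T+c≡a = trans (m+toℕ[modFin-n]%o≡[m+n]%o T _) ([m+[n+k*m]]%[1+k]≡n%[1+k] k' T (toℕ a))

  T+d+c≡b : (T + d + toℕ c) % K ≡ toℕ b % K
  T+d+c≡b = begin
    (T + d + toℕ c) % K        ≡⟨ cong (_% K) (+-assoc T d (toℕ c)) ⟩
    (T + (d + toℕ c)) % K      ≡⟨ cong (λ x → (T + x) % K) (+-comm d (toℕ c)) ⟩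
    (T + (toℕ c + d)) % K      ≡⟨ cong (_% K) (+-assoc T (toℕ c) d) ⟨
    (T + toℕ c + d) % K        ≡⟨ %-cong-+ʳ {u = T + toℕ c} {v = toℕ a} d T+c≡a ⟩
    (toℕ a + d) % K            ≡⟨ [m+n%o]%o≡[m+n]%o (toℕ a) (toℕ b + k' * toℕ a) ⟩
    (toℕ a + (toℕ b + k' * toℕ a)) % K  ≡⟨ [m+[n+k*m]]%[1+k]≡n%[1+k] k' (toℕ a) (toℕ b) ⟩
    toℕ b % K                  ∎

  r+0≡r : modFin M (toℕ r + 0) ≡ r
  r+0≡r = trans (cong (modFin M) (+-identityʳ (toℕ r))) (modFin-toℕ r)

  top : window n (A (modFin M (toℕ r + 0))) c ≗ window n s a
  top = window-of-shifted s T c (λ col → trans (cong (λ row → A row col) r+0≡r) (row₀ col))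
    (modFin-≡ (T + toℕ c) (trans T+c≡a (toℕ%≡toℕ a)))

  bottom : window n (A (modFin M (toℕ r + 1))) c ≗ window n s b
  bottom = window-of-shifted s (T + d) c row₁
    (modFin-≡ (T + d + toℕ c) (trans T+d+c≡b (toℕ%≡toℕ b)))

  windows-match : dist2 B (window2 2 n A r c)
                ≡ dist (B fzero) (window n s a) + (dist (B (fsuc fzero)) (window n s b) + 0)
  windows-match =
    cong₂ (λ x y → x + (y + 0)) (dist-congʳ (B fzero) top) (dist-congʳ (B (fsuc fzero)) bottom)

  bound : dist2 B (window2 2 n A r c) ≤ 2 * R
  bound = ≤-trans (≤-reflexive windows-match) (+-mono-≤ a-close (+-mono-≤ b-close z≤n))

tri-suc : ∀ i → tri (suc i) ≡ tri i + suc i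
tri-suc i = begin
  suc i * suc (suc i) / 2      ≡⟨ /-congˡ (solve 1 (λ i → (con 1 :+ i) :* (con 2 :+ i)
                                                    := i :* (con 1 :+ i) :+ (con 1 :+ i) :* con 2) refl i) ⟩
  (i * suc i + suc i * 2) / 2  ≡⟨ +-distrib-/-∣ʳ (i * suc i) (n∣m*n (suc i)) ⟩
  tri i + suc i * 2 / 2        ≡⟨ cong (tri i +_) (m*n/n≡m (suc i) 2) ⟩
  tri i + suc i                ∎

2∣n⊎2∣1+n : ∀ n → 2 ∣ n ⊎ 2 ∣ suc n
2∣n⊎2∣1+n zero = inj₁ (2 ∣0)
2∣n⊎2∣1+n (suc n) with 2∣n⊎2∣1+n n
... | inj₁ 2∣n   = inj₂ (∣m∣n⇒∣m+n ∣-refl 2∣n)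
... | inj₂ 2∣1+n = inj₁ 2∣1+n

2∣n⇒1+n∣tri[n] : ∀ {n} → 2 ∣ n → suc n ∣ tri n
2∣n⇒1+n∣tri[n] {n} 2∣n = subst (suc n ∣_) (begin
  suc n * (n / 2)  ≡⟨ *-/-assoc (suc n) 2∣n ⟨
  suc n * n / 2    ≡⟨ /-congˡ (*-comm (suc n) n) ⟩
  tri n            ∎) (m∣m*n (n / 2))

2∤1+n⇒1+n∣tri[n] : ∀ {n} → ¬ 2 ∣ suc n → suc n ∣ tri n
2∤1+n⇒1+n∣tri[n] {n} 2∤1+n with 2∣n⊎2∣1+n n
... | inj₁ 2∣n   = 2∣n⇒1+n∣tri[n] 2∣n
... | inj₂ 2∣1+n = contradiction 2∣1+n 2∤1+n

next-row-index : ∀ {M} .{{_ : NonZero M}} (r : Fin M) {i} → toℕ r ≡ i → suc i < M →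
  toℕ (modFin M (toℕ r + 1)) ≡ suc i
next-row-index {M} r refl 1+i<M =
  trans (toℕ-modFin (toℕ r + 1)) (trans (cong (_% M) (+-comm (toℕ r) 1)) (m<n⇒m%n≡m 1+i<M))

TriangularRows : ∀ {M K} .{{_ : NonZero M}} .{{_ : NonZero K}} →
  (Fin M → Fin K → Bool) → (Fin K → Bool) → Set
TriangularRows {M} {K} A s = ∀ (r : Fin M) i → toℕ r ≡ i → i < K → A r ≗ shift (tri i) s

triangularRows⇒rowsShiftedBy-suc : ∀ {M} .{{_ : NonZero M}}
  (A : Fin M → Fin (suc k') → Bool) (s : Fin (suc k') → Bool) → suc k' ≤ M → TriangularRows A s →
  ∀ {i} → suc i < suc k' → RowsShiftedBy A s (suc i)
triangularRows⇒rowsShiftedBy-suc {M = M} A s K≤M rows {i} 1+i<K =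
  r , tri i , rows r i r≡i i<K , λ col →
    trans (rows _ (suc i) (next-row-index r r≡i (<-≤-trans 1+i<K K≤M)) 1+i<K col)
          (cong (λ T → shift T s col) (tri-suc i))
  where
  i<K = <-trans (n<1+n i) 1+i<K
  r : Fin M
  r = fromℕ< (<-≤-trans i<K K≤M)
  r≡i : toℕ r ≡ i
  r≡i = toℕ-fromℕ< _

covering2D-of-triangularRows : ∀ {M} .{{_ : NonZero M}}
  (A : Fin M → Fin (suc k') → Bool) (s : Fin (suc k') → Bool) →
  IsCoveringSeq n R s → suc k' ≤ M → TriangularRows A s → RowsShiftedBy A s 0 →
  IsCovering2D 2 n (2 * R) A
covering2D-of-triangularRows A s cov K≤M rows rows₀ =
  covering2D-of-rowsShiftedBy A s cov λ where
    zero    _     → rows₀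
    (suc i) 1+i<K → triangularRows⇒rowsShiftedBy-suc A s K≤M rows 1+i<K

module _ {k'} (s : Fin (suc k') → Bool) where

  arrayEven-triangular : TriangularRows (arrayEven s) s
  arrayEven-triangular r i refl i<K rewrite dec-false (toℕ r ≟ suc k') (<⇒≢ i<K) = λ _ → refl

  arrayEven-last : (r : Fin (suc (suc k'))) → toℕ r ≡ suc k' → arrayEven s r ≗ shift (tri k') s
  arrayEven-last r r≡K rewrite dec-true (toℕ r ≟ suc k') r≡K = λ _ → refl

  arrayEven-rowsShiftedBy-0 : RowsShiftedBy (arrayEven s) s 0
  arrayEven-rowsShiftedBy-0 =
    r , tri k' , arrayEven-triangular r k' r≡k' (n<1+n k') , λ col →
      trans (arrayEven-last _ (next-row-index r r≡k' (n<1+n (suc k'))) col)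
            (cong (λ T → shift T s col) (sym (+-identityʳ (tri k'))))
    where
    r : Fin (suc (suc k'))
    r = fromℕ< (m<n⇒m<1+n (n<1+n k'))
    r≡k' : toℕ r ≡ k'
    r≡k' = toℕ-fromℕ< _

  arrayOdd-triangular : TriangularRows (arrayOdd s) s
  arrayOdd-triangular r i r≡i _ col = cong (λ j → shift (tri j) s col) r≡i

  arrayOdd-rowsShiftedBy-0 : ¬ 2 ∣ suc k' → RowsShiftedBy (arrayOdd s) s 0
  arrayOdd-rowsShiftedBy-0 2∤K =
    r , tri k' , arrayOdd-triangular r k' r≡k' (n<1+n k') , λ col →
      trans (cong (λ j → shift (tri j) s col) wraps-to-0)
            (shift-cong-% s (tri 0) (tri k' + 0) tri[k']≡tri[0] col)
    where
    r : Fin (suc k')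
    r = fromℕ< (n<1+n k')
    r≡k' : toℕ r ≡ k'
    r≡k' = toℕ-fromℕ< _
    wraps-to-0 : toℕ (modFin (suc k') (toℕ r + 1)) ≡ 0
    wraps-to-0 = trans (toℕ-modFin (toℕ r + 1))
      (trans (cong (λ j → (j + 1) % suc k') r≡k')
      (trans (cong (_% suc k') (+-comm k' 1)) (n%n≡0 (suc k'))))
    tri[k']≡tri[0] : tri 0 % suc k' ≡ (tri k' + 0) % suc k'
    tri[k']≡tri[0] = sym (trans (cong (_% suc k') (+-identityʳ (tri k')))
                               (n∣m⇒m%n≡0 (tri k') (suc k') (2∤1+n⇒1+n∣tri[n] 2∤K)))

theorem8 : (k n R : ℕ) → .{{_ : NonZero k}} → (s : Fin k → Bool) →
    IsCoveringSeq n R s →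
    ((2 ∣ k) → IsCovering2D 2 n (2 * R) (arrayEven s))
    × ((¬ (2 ∣ k)) → IsCovering2D 2 n (2 * R) (arrayOdd s))
-- The (k + 1)-row array works for every k.
theorem8 (suc k') n R s cov =
    (λ _ → covering2D-of-triangularRows (arrayEven s) s cov (n≤1+n (suc k'))
             (arrayEven-triangular s) (arrayEven-rowsShiftedBy-0 s))
  , (λ 2∤k → covering2D-of-triangularRows (arrayOdd s) s cov ≤-refl
             (arrayOdd-triangular s) (arrayOdd-rowsShiftedBy-0 s 2∤k))
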